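{- Let $k$ and $n$ be nonnegative integers with $n>2k$. Then $$\sum_{j=0}^{k}\binom{k}{j}q(n-k-j)\leqslant F_n.$$
   Context: $q(n)$ denotes the number of partitions of the positive integer $n$ into odd parts; $q(0)=1$ and $q(n)=0$ for negative $n$. $F_n$ is the $n$-th Fibonacci number: $F_0=0$, $F_1=1$, $F_n=F_{n-1}+F_{n-2}$. -}

module Defs where

open import Data.Nat using (ℕ; zero; suc; _+_; _*_; _∸_; _≤ᵇ_)
open import Data.Bool using (if_then_else_)

sumTo : ℕ → (ℕ → ℕ) → ℕ
sumTo zero    f = f 0
sumTo (suc n) f = sumTo n f + f (suc n)

-- oddPartsBounded m n = number of partitions of n into odd parts,
-- each part lying in {1, 3, ..., 2m-1}.  Recursion on m: choose the
-- multiplicity j of the largest allowed part 2m-1 = 2(m-1)+1.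
oddPartsBounded : ℕ → ℕ → ℕ
oddPartsBounded zero    zero    = 1
oddPartsBounded zero    (suc n) = 0
oddPartsBounded (suc m) n =
  sumTo n (λ j → if j * (2 * m + 1) ≤ᵇ n
                   then oddPartsBounded m (n ∸ j * (2 * m + 1))
                   else 0)

-- q n = number of partitions of n into odd parts (q 0 = 1).
-- Every odd part of a partition of n is ≤ n ≤ 2n-1, so bound m = n suffices.
q : ℕ → ℕ
q n = oddPartsBounded n n

fib : ℕ → ℕ
fib zero = 0
fib (suc zero) = 1
fib (suc (suc n)) = fib (suc n) + fib n

{-# OPTIONS --safe #-}
module Submission where

-- Write p m for the number of partitions into odd parts at most 2m-1. Admitting the
-- part d = 2m+1 gives p (m+1) n = p (m+1) (n-d) + p m n, and this step preserves the
-- recurrence f (n+2) ≤ f (n+1) + f n: the only place where the correction term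
-- p (m+1) (n-d) breaks it is n+2 = d, and there p m itself satisfies the recurrence
-- with one unit to spare, because its own last step added exactly one partition at
-- each of 2m-1, 2m, 2m+1.  Hence q n ≤ F n.  Finally the left-hand side S k n satisfies
-- S (k+1) (n+2) = S k (n+1) + S k n by Pascal's rule, so S k n ≤ F n by induction on k.

open import Defs
open import Data.Nat
  using (ℕ; zero; suc; _+_; _*_; _∸_; _≤_; _<_; _≤′_; ≤′-refl; ≤′-step; _≤ᵇ_; z≤n; s≤s)
open import Data.Nat.Properties
open import Data.Nat.Combinatorics using (_C_; k>n⇒nCk≡0; nCk+nC[k+1]≡[n+1]C[k+1])
open import Data.Nat.Induction using (<-rec)
open import Data.Bool using (true; false; if_then_else_)
open import Algebra.Properties.CommutativeSemigroup +-commutativeSemigroup using (interchange)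
open import Function using (_∘_)
open import Relation.Binary.PropositionalEquality
open import Relation.Nullary using (¬_; yes; no; contradiction)
open import Relation.Nullary.Reflects using (ofʸ; ofⁿ)

sumTo-cong : ∀ n {f g : ℕ → ℕ} → (∀ j → f j ≡ g j) → sumTo n f ≡ sumTo n g
sumTo-cong zero    f≗g = f≗g 0
sumTo-cong (suc n) f≗g = cong₂ _+_ (sumTo-cong n f≗g) (f≗g (suc n))

sumTo-shift : ∀ n (f : ℕ → ℕ) → sumTo (suc n) f ≡ f 0 + sumTo n (f ∘ suc)
sumTo-shift zero    f = refl
sumTo-shift (suc n) f = begin
  sumTo (suc n) f + f (suc (suc n))           ≡⟨ cong (_+ f (suc (suc n))) (sumTo-shift n f) ⟩
  f 0 + sumTo n (f ∘ suc) + f (suc (suc n))   ≡⟨ +-assoc (f 0) _ _ ⟩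
  f 0 + sumTo (suc n) (f ∘ suc)               ∎
  where open ≡-Reasoning

sumTo-distrib-+ : ∀ n (f g : ℕ → ℕ) → sumTo n (λ j → f j + g j) ≡ sumTo n f + sumTo n g
sumTo-distrib-+ zero    f g = refl
sumTo-distrib-+ (suc n) f g = trans (cong (_+ (f (suc n) + g (suc n))) (sumTo-distrib-+ n f g))
                                    (interchange (sumTo n f) (sumTo n g) (f (suc n)) (g (suc n)))

sumTo-tail-zero : ∀ {m n} (f : ℕ → ℕ) → (∀ j → n < j → f j ≡ 0) → n ≤ m →
  sumTo m f ≡ sumTo n f
sumTo-tail-zero {n = n} f vanish n≤m = go (≤⇒≤′ n≤m)
  where
  go : ∀ {m} → n ≤′ m → sumTo m f ≡ sumTo n f
  go ≤′-refl        = refl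
  go (≤′-step n≤′m) =
    trans (cong₂ _+_ (go n≤′m) (vanish _ (s≤s (≤′⇒≤ n≤′m)))) (+-identityʳ _)

if-≤ᵇ-yes : ∀ {A : Set} {m n} {x y : A} → m ≤ n → (if m ≤ᵇ n then x else y) ≡ x
if-≤ᵇ-yes {m = m} {n} m≤n with m ≤ᵇ n | ≤ᵇ-reflects-≤ m n
... | true  | _         = refl
... | false | ofⁿ m≰n   = contradiction m≤n m≰n

if-≤ᵇ-no : ∀ {A : Set} {m n} {x y : A} → ¬ m ≤ n → (if m ≤ᵇ n then x else y) ≡ y
if-≤ᵇ-no {m = m} {n} m≰n with m ≤ᵇ n | ≤ᵇ-reflects-≤ m n
... | true  | ofʸ m≤n   = contradiction m≤n m≰n
... | false | _         = refl

sumTo-pascal : ∀ k (g : ℕ → ℕ) →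
  sumTo (suc k) (λ j → (suc k C j) * g j) ≡
  sumTo k (λ j → (k C j) * g j) + sumTo k (λ j → (k C j) * g (suc j))
sumTo-pascal k g = begin
  sumTo (suc k) (λ j → (suc k C j) * g j)         ≡⟨ sumTo-shift k _ ⟩
  1 * g 0 + sumTo k (λ j → (suc k C suc j) * g (suc j))
    ≡⟨ cong (1 * g 0 +_) (trans (sumTo-cong k pascal) (sumTo-distrib-+ k _ _)) ⟩
  1 * g 0 + (A + B)                                ≡⟨ cong (1 * g 0 +_) (+-comm A B) ⟩
  1 * g 0 + (B + A)                                ≡⟨ +-assoc (1 * g 0) B A ⟨
  1 * g 0 + B + A                                  ≡⟨ cong (_+ A) (sumTo-shift k _) ⟨
  sumTo (suc k) (λ j → (k C j) * g j) + A          ≡⟨ cong (_+ A) last-vanishes ⟩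
  sumTo k (λ j → (k C j) * g j) + A                ∎
  where
  open ≡-Reasoning
  A = sumTo k (λ j → (k C j) * g (suc j))
  B = sumTo k (λ j → (k C suc j) * g (suc j))
  pascal : ∀ j → (suc k C suc j) * g (suc j) ≡ (k C j) * g (suc j) + (k C suc j) * g (suc j)
  pascal j = trans (cong (_* g (suc j)) (sym (nCk+nC[k+1]≡[n+1]C[k+1] k j)))
                   (*-distribʳ-+ (g (suc j)) (k C j) (k C suc j))
  last-vanishes : sumTo (suc k) (λ j → (k C j) * g j) ≡ sumTo k (λ j → (k C j) * g j)
  last-vanishes =
    trans (cong (λ c → sumTo k (λ j → (k C j) * g j) + c * g (suc k)) (k>n⇒nCk≡0 (n<1+n k)))
          (+-identityʳ _)

record AddsPart (d : ℕ) (f g : ℕ → ℕ) : Set where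
  field
    below : ∀ {n} → n < d → g n ≡ f n
    above : ∀ n → g (n + d) ≡ g n + f (n + d)

multiplicityTerm : ℕ → (ℕ → ℕ) → ℕ → ℕ → ℕ
multiplicityTerm d f n j = if j * d ≤ᵇ n then f (n ∸ j * d) else 0

countWithPart : ℕ → (ℕ → ℕ) → ℕ → ℕ
countWithPart d f n = sumTo n (multiplicityTerm d f n)

multiplicityTerm-vanishes : ∀ c f {n j} → n < j → multiplicityTerm (suc c) f n j ≡ 0
multiplicityTerm-vanishes c f {n} {j} n<j =
  if-≤ᵇ-no (λ j*d≤n → <⇒≱ n<j (≤-trans (m≤m*n j (suc c)) j*d≤n))

multiplicityTerm-shift : ∀ c f n j →
  multiplicityTerm (suc c) f (suc c + n) (suc j) ≡ multiplicityTerm (suc c) f n j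
multiplicityTerm-shift c f n j with j * suc c ≤? n
... | yes j*d≤n = begin
  multiplicityTerm (suc c) f (suc c + n) (suc j)  ≡⟨ if-≤ᵇ-yes (+-monoʳ-≤ (suc c) j*d≤n) ⟩
  f (suc c + n ∸ (suc c + j * suc c))             ≡⟨ cong f ([m+n]∸[m+o]≡n∸o (suc c) n (j * suc c)) ⟩
  f (n ∸ j * suc c)                               ≡⟨ if-≤ᵇ-yes j*d≤n ⟨
  multiplicityTerm (suc c) f n j                  ∎
  where open ≡-Reasoning
... | no j*d≰n = trans (if-≤ᵇ-no (j*d≰n ∘ +-cancelˡ-≤ (suc c) _ _)) (sym (if-≤ᵇ-no j*d≰n))

countWithPart-addsPart : ∀ c f → AddsPart (suc c) f (countWithPart (suc c) f)
countWithPart-addsPart c f = record { below = below ; above = above }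
  where
  d = suc c
  below : ∀ {n} → n < d → countWithPart d f n ≡ f n
  below {n} n<d = sumTo-tail-zero {n} (multiplicityTerm d f n) vanish z≤n
    where
    vanish : ∀ j → 0 < j → multiplicityTerm d f n j ≡ 0
    vanish (suc j) _ =
      if-≤ᵇ-no (λ [1+j]*d≤n → <⇒≱ n<d (≤-trans (m≤m+n d (j * d)) [1+j]*d≤n))
  above : ∀ n → countWithPart d f (n + d) ≡ countWithPart d f n + f (n + d)
  above n = begin
    countWithPart d f (n + d)                           ≡⟨ cong (countWithPart d f) (+-comm n d) ⟩
    countWithPart d f (d + n)                           ≡⟨ sumTo-shift (c + n) _ ⟩
    f (d + n) + sumTo (c + n) (multiplicityTerm d f (d + n) ∘ suc)
      ≡⟨ cong (f (d + n) +_) (sumTo-cong (c + n) (multiplicityTerm-shift c f n)) ⟩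
    f (d + n) + sumTo (c + n) (multiplicityTerm d f n)
      ≡⟨ cong (f (d + n) +_) (sumTo-tail-zero {c + n} _ (λ _ → multiplicityTerm-vanishes c f)
                                                     (m≤n+m n c)) ⟩
    f (d + n) + countWithPart d f n                     ≡⟨ +-comm (f (d + n)) _ ⟩
    countWithPart d f n + f (d + n)                     ≡⟨ cong (λ m → countWithPart d f n + f m) (+-comm d n) ⟩
    countWithPart d f n + f (n + d)                     ∎
    where open ≡-Reasoning

-- oddPartsBounded (suc m) unfolds to countWithPart (2 * m + 1) (oddPartsBounded m).
oddPartsBounded-addsPart : ∀ m → AddsPart (2 * m + 1) (oddPartsBounded m) (oddPartsBounded (suc m))
oddPartsBounded-addsPart m =
  subst (λ d → AddsPart d (oddPartsBounded m) (countWithPart d (oddPartsBounded m)))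
        (+-comm 1 (2 * m)) (countWithPart-addsPart (2 * m) (oddPartsBounded m))

SubFibonacci : (ℕ → ℕ) → Set
SubFibonacci f = ∀ n → f (2 + n) ≤ f (1 + n) + f n

subFibonacci-≤-fib : ∀ {f} → SubFibonacci f → f 1 ≤ 1 → f 2 ≤ 1 →
  ∀ n → f (suc n) ≤ fib (suc n)
subFibonacci-≤-fib {f} sub f1≤1 f2≤1 = go
  where
  go : ∀ n → f (suc n) ≤ fib (suc n)
  go zero          = f1≤1
  go (suc zero)    = f2≤1
  go (suc (suc n)) = ≤-trans (sub (1 + n)) (+-mono-≤ (go (suc n)) (go n))

data Position (c : ℕ) : ℕ → Set where
  early   : ∀ {e} → e < c → Position c e
  at      : Position c c
  after   : Position c (1 + c)
  later   : ∀ e → Position c (e + (2 + c))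

position : ∀ c e → Position c e
position zero    zero                = at
position zero    (suc zero)          = after
position zero    (suc (suc e))       = subst (Position 0) (+-comm e 2) (later e)
position (suc c) zero                = early (s≤s z≤n)
position (suc c) (suc e) with position c e
... | early e<c = early (s≤s e<c)
... | at        = at
... | after     = after
... | later e′  = subst (Position (suc c)) (+-suc e′ (2 + c)) (later e′)

addsPart-gap : ∀ {d f g} → AddsPart d f g → g 0 ≡ 1 → g 1 ≡ 1 → g 2 ≡ 1 →
  SubFibonacci f → 1 + g (2 + d) ≤ g (1 + d) + g d
addsPart-gap {d} {f} {g} g-adds g0 g1 g2 f-sub = begin
  1 + g (2 + d)                ≡⟨ cong suc (trans (above 2) (cong (_+ f (2 + d)) g2)) ⟩
  2 + f (2 + d)                ≤⟨ s≤s (s≤s (f-sub d)) ⟩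
  2 + (f (1 + d) + f d)        ≡⟨ cong suc (+-suc (f (1 + d)) (f d)) ⟨
  (1 + f (1 + d)) + (1 + f d)  ≡⟨ cong₂ _+_ (trans (above 1) (cong (_+ f (1 + d)) g1))
                                            (trans (above 0) (cong (_+ f d) g0)) ⟨
  g (1 + d) + g d              ∎
  where
  open AddsPart g-adds
  open ≤-Reasoning

subFibonacci-addsPart : ∀ {c f g} → AddsPart (2 + c) f g → g 0 ≡ 1 → g 1 ≡ 1 →
  SubFibonacci f → 1 + f (2 + c) ≤ f (1 + c) + f c → SubFibonacci g
subFibonacci-addsPart {c} {f} {g} g-adds g0 g1 f-sub gap = <-rec _ step
  where
  open AddsPart g-adds
  open ≤-Reasoning
  d = 2 + c
  g-at-d : g d ≡ 1 + f d
  g-at-d = trans (above 0) (cong (_+ f d) g0)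
  step : ∀ e → (∀ {e′} → e′ < e → g (2 + e′) ≤ g (1 + e′) + g e′) →
         g (2 + e) ≤ g (1 + e) + g e
  step e rec with position c e
  ... | early e<c = begin
    g (2 + e)          ≡⟨ below 2+e<d ⟩
    f (2 + e)          ≤⟨ f-sub e ⟩
    f (1 + e) + f e    ≡⟨ cong₂ _+_ (below 1+e<d) (below e<d) ⟨
    g (1 + e) + g e    ∎
    where
    2+e<d : 2 + e < d
    2+e<d = s≤s (s≤s e<c)
    1+e<d : 1 + e < d
    1+e<d = <-trans (n<1+n (1 + e)) 2+e<d
    e<d : e < d
    e<d = <-trans (n<1+n e) 1+e<d
  ... | at = begin
    g d                ≡⟨ g-at-d ⟩
    1 + f d            ≤⟨ gap ⟩
    f (1 + c) + f c    ≡⟨ cong₂ _+_ (below (n<1+n (1 + c)))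
                                    (below (<-trans (n<1+n c) (n<1+n (1 + c)))) ⟨
    g (1 + c) + g c    ∎
  ... | after = begin
    g (1 + d)              ≡⟨ trans (above 1) (cong (_+ f (1 + d)) g1) ⟩
    1 + f (1 + d)          ≤⟨ s≤s (f-sub (1 + c)) ⟩
    (1 + f d) + f (1 + c)  ≡⟨ cong₂ _+_ g-at-d (below (n<1+n (1 + c))) ⟨
    g d + g (1 + c)        ∎
  ... | later e′ = begin
    g (2 + e′ + d)                                       ≡⟨ above (2 + e′) ⟩
    g (2 + e′) + f (2 + e′ + d)                          ≤⟨ +-mono-≤ (rec (m<m+n e′ (s≤s z≤n))) (f-sub (e′ + d)) ⟩
    (g (1 + e′) + g e′) + (f (1 + e′ + d) + f (e′ + d))  ≡⟨ interchange (g (1 + e′)) (g e′) (f (1 + e′ + d)) (f (e′ + d)) ⟩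
    (g (1 + e′) + f (1 + e′ + d)) + (g e′ + f (e′ + d))  ≡⟨ cong₂ _+_ (above (1 + e′)) (above e′) ⟨
    g (1 + e′ + d) + g (e′ + d)                          ∎

oddPartsBounded-one : ∀ n → oddPartsBounded 1 n ≡ 1
oddPartsBounded-one zero    = refl
oddPartsBounded-one (suc n) = begin
  oddPartsBounded 1 (suc n)                         ≡⟨ cong (oddPartsBounded 1) (+-comm 1 n) ⟩
  oddPartsBounded 1 (n + 1)                         ≡⟨ AddsPart.above (oddPartsBounded-addsPart 0) n ⟩
  oddPartsBounded 1 n + oddPartsBounded 0 (n + 1)
    ≡⟨ cong₂ _+_ (oddPartsBounded-one n) (cong (oddPartsBounded 0) (+-comm n 1)) ⟩
  1 + oddPartsBounded 0 (suc n)                     ∎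
  where open ≡-Reasoning

oddPartsBounded-small : ∀ m {n} → n ≤ 2 → oddPartsBounded (suc m) n ≡ 1
oddPartsBounded-small zero    {n} _ = oddPartsBounded-one n
oddPartsBounded-small (suc m) {n} n≤2 =
  trans (AddsPart.below (oddPartsBounded-addsPart (suc m)) n<d) (oddPartsBounded-small m n≤2)
  where
  n<d : n < 2 * suc m + 1
  n<d = ≤-trans (s≤s n≤2) (+-monoˡ-≤ 1 (*-monoʳ-≤ 2 (s≤s z≤n)))

subFibonacci-oddPartsBounded : ∀ m → SubFibonacci (oddPartsBounded m)
subFibonacci-oddPartsBounded zero          n = z≤n
subFibonacci-oddPartsBounded (suc zero)    n
  rewrite oddPartsBounded-one (2 + n) | oddPartsBounded-one (1 + n) | oddPartsBounded-one n = s≤s z≤n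
subFibonacci-oddPartsBounded (suc (suc m)) =
  subFibonacci-addsPart next (oddPartsBounded-small (suc m) z≤n) (oddPartsBounded-small (suc m) (s≤s z≤n))
    (subFibonacci-oddPartsBounded (suc m))
    (addsPart-gap (oddPartsBounded-addsPart m)
      (oddPartsBounded-small m z≤n) (oddPartsBounded-small m (s≤s z≤n)) (oddPartsBounded-small m ≤-refl)
      (subFibonacci-oddPartsBounded m))
  where
  next : AddsPart (2 + (2 * m + 1)) (oddPartsBounded (suc m)) (oddPartsBounded (suc (suc m)))
  next = subst (λ d → AddsPart d (oddPartsBounded (suc m)) (oddPartsBounded (suc (suc m))))
               (cong (_+ 1) (*-suc 2 m)) (oddPartsBounded-addsPart (suc m))

q-≤-fib : ∀ n → q (suc n) ≤ fib (suc n)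
q-≤-fib n = subFibonacci-≤-fib {oddPartsBounded (suc n)} (subFibonacci-oddPartsBounded (suc n))
  (≤-reflexive (oddPartsBounded-small n (s≤s z≤n))) (≤-reflexive (oddPartsBounded-small n ≤-refl)) n

[1+a]∸b∸[1+c]≡a∸b∸c : ∀ a b c → suc a ∸ b ∸ suc c ≡ a ∸ b ∸ c
[1+a]∸b∸[1+c]≡a∸b∸c a b c = begin
  suc a ∸ b ∸ suc c    ≡⟨ ∸-+-assoc (suc a) b (suc c) ⟩
  suc a ∸ (b + suc c)  ≡⟨ cong (suc a ∸_) (+-suc b c) ⟩
  a ∸ (b + c)          ≡⟨ ∸-+-assoc a b c ⟨
  a ∸ b ∸ c            ∎
  where open ≡-Reasoning

binomialSum-≤-fib : (h : ℕ → ℕ) → (∀ n → h (suc n) ≤ fib (suc n)) →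
  ∀ k n → 2 * k < n → sumTo k (λ j → (k C j) * h (n ∸ k ∸ j)) ≤ fib n
binomialSum-≤-fib h h≤fib zero    (suc n)       _  = ≤-trans (≤-reflexive (*-identityˡ _)) (h≤fib n)
binomialSum-≤-fib h h≤fib (suc k) (suc zero)    (s≤s ())
binomialSum-≤-fib h h≤fib (suc k) (suc (suc n)) lt = begin
  sumTo (suc k) (λ j → (suc k C j) * h (suc n ∸ k ∸ j))           ≡⟨ sumTo-pascal k _ ⟩
  S (suc n) + sumTo k (λ j → (k C j) * h (suc n ∸ k ∸ suc j))
    ≡⟨ cong (S (suc n) +_) (sumTo-cong k λ j → cong (λ m → (k C j) * h m) ([1+a]∸b∸[1+c]≡a∸b∸c n k j)) ⟩
  S (suc n) + S n
    ≤⟨ +-mono-≤ (binomialSum-≤-fib h h≤fib k (suc n) (m<n⇒m<1+n 2k<n))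
                (binomialSum-≤-fib h h≤fib k n 2k<n) ⟩
  fib (suc n) + fib n ∎
  where
  open ≤-Reasoning
  S : ℕ → ℕ
  S n = sumTo k (λ j → (k C j) * h (n ∸ k ∸ j))
  2k<n : 2 * k < n
  2k<n = ≤-pred (≤-pred (subst (_< suc (suc n)) (*-suc 2 k) lt))

proposition1 : (k n : ℕ) → 2 * k < n →
    sumTo k (λ j → (k C j) * q (n ∸ k ∸ j)) ≤ fib n
proposition1 = binomialSum-≤-fib q q-≤-fib
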